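{- Let $k,n\in\mathbb{N}$ with $4\le k\le n-2$. Let $\mathcal{H}$ be a hierarchy on $[n]$ all of whose clusters have cardinality between $2$ and $n-k$. For $t\in\bigcup_{H\in\mathcal{H}}H$ let $m_t$ be the minimal $\mathcal{H}$-cluster containing $t$ and $M_t$ the maximal $\mathcal{H}$-cluster containing $t$. Let $i,l\in[n]$ and $X\in\binom{[n]\setminus\{i,l\}}{k-1}$ satisfy: - if $i,l\in\bigcup_{H}H$ and $M_i\cap M_l=\emptyset$: $X$ contains an element $\bar i\in m_i$ with $\bar i\ne i$ and an element $\bar l\in m_l$ with $\bar l\neq l$; - if $i,l\in\bigcup_H H$ and $M_i\cap M_l\ne\emptyset$: if $m_i\subset m_l$, $X$ contains an element $\bar i\in m_i\setminus\{i\}$ and an element $\hat i\in[n]\setminus M_i$; if $m_l\subset m_i$, $X$ contains an element $\bar l\in m_l\setminus\{l\}$ and an element $\hat l\in[n]\setminus M_l$; if $m_i\cap m_l=\emptyset$, $X$ contains an element $\bar i\in m_i\setminus\{i\}$, an element $\bar l\in m_l\setminus\{l\}$ and an element $\hat i\in[n]\setminus M_i$; - if $i\in\bigcup_H H$ and $l\notin\bigcup_H H$: $X$ contains an element $\bar i\in m_i\setminus\{i\}$ and an element $\hat i\in[n]\setminus M_i$; - if $l\in\bigcup_H H$ and $i\notin\bigcup_H H$: $X$ contains an element $\bar l\in m_l\setminus\{l\}$ and an element $\hat l\in[n]\setminus M_l$. Then, in the free $\mathbb{Z}$-module $\bigoplus_{H\in\mathcal{H}}\mathbb{Z}H$, $$\sum_{\substack{H\in\mathcal{H},\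 H\cap(\{i\}\cup X)\ne\emptyset,\\ H\not\supset \{i\}\cup X}}H\;-\;\sum_{\substack{H\in\mathcal{H},\ H\cap(\{l\}\cup X)\ne\emptyset,\\ H\not\supset \{l\}\cup X}}H=0.$$
   Context: $[n]=\{1,\dots,n\}$. A hierarchy on a set $S$ is a family $\mathcal{H}$ of subsets of $S$ (called $\mathcal{H}$-clusters) such that for all $H,H'\in\mathcal{H}$, $H\cap H'$ is one of $\emptyset,H,H'$. The free $\mathbb{Z}$-module $\bigoplus_{H\in\mathcal{H}}\mathbb{Z}H$ has the clusters of $\mathcal{H}$ as a basis. -}

module Defs where

open import Data.Nat using (ℕ; zero; suc; _≤_; _∸_)
open import Data.Fin using (Fin; zero; suc; _≟_)
open import Data.Fin.Subset using (Subset; _∈_; _∉_; _⊆_; _∩_; _∪_; ⁅_⁆; ∣_∣; Empty; ⊥)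
open import Data.Fin.Subset.Properties using (nonempty?; _⊆?_)
open import Data.Integer using (ℤ; 0ℤ; 1ℤ; _+_; _-_)
open import Data.Bool using (Bool; true; false; _∧_; not; if_then_else_)
open import Data.Product using (_×_; ∃)
open import Data.Sum using (_⊎_)
open import Relation.Nullary using (¬_; does)
open import Relation.Binary.PropositionalEquality using (_≡_; _≢_)

Family : ℕ → ℕ → Set
Family n m = Fin m → Subset n

-- Hierarchy: distinct members (a family of subsets, i.e. a set), laminar.
record IsHierarchy {n m : ℕ} (𝓗 : Family n m) : Set where
  field
    distinct : ∀ a b → 𝓗 a ≡ 𝓗 b → a ≡ b
    laminar  : ∀ a b → (𝓗 a ∩ 𝓗 b ≡ ⊥) ⊎ (𝓗 a ∩ 𝓗 b ≡ 𝓗 a) ⊎ (𝓗 a ∩ 𝓗 b ≡ 𝓗 b)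

InUnion : ∀ {n m} → Family n m → Fin n → Set
InUnion 𝓗 t = ∃ λ a → t ∈ 𝓗 a

IsMinCl : ∀ {n m} → Family n m → Fin n → Fin m → Set
IsMinCl 𝓗 t a = t ∈ 𝓗 a × (∀ b → t ∈ 𝓗 b → 𝓗 a ⊆ 𝓗 b)

IsMaxCl : ∀ {n m} → Family n m → Fin n → Fin m → Set
IsMaxCl 𝓗 t a = t ∈ 𝓗 a × (∀ b → t ∈ 𝓗 b → 𝓗 b ⊆ 𝓗 a)

HasBar : ∀ {n} → Subset n → Subset n → Fin n → Set
HasBar X H t = ∃ λ x → x ∈ X × x ∈ H × x ≢ t

HasHat : ∀ {n} → Subset n → Subset n → Set
HasHat X M = ∃ λ x → x ∈ X × x ∉ M

-- The four hypotheses on (i, l, X).  m_t and M_t are referred to through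
-- the indices of the minimal / maximal clusters containing t.
record Admissible {n m : ℕ} (𝓗 : Family n m) (i l : Fin n) (X : Subset n) : Set where
  field
    case-disj : InUnion 𝓗 i → InUnion 𝓗 l →
      ∀ mi Mi ml Ml → IsMinCl 𝓗 i mi → IsMaxCl 𝓗 i Mi → IsMinCl 𝓗 l ml → IsMaxCl 𝓗 l Ml →
      Empty (𝓗 Mi ∩ 𝓗 Ml) →
      HasBar X (𝓗 mi) i × HasBar X (𝓗 ml) l
    case-meet-i⊆l : InUnion 𝓗 i → InUnion 𝓗 l →
      ∀ mi Mi ml Ml → IsMinCl 𝓗 i mi → IsMaxCl 𝓗 i Mi → IsMinCl 𝓗 l ml → IsMaxCl 𝓗 l Ml →
      ¬ Empty (𝓗 Mi ∩ 𝓗 Ml) → 𝓗 mi ⊆ 𝓗 ml →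
      HasBar X (𝓗 mi) i × HasHat X (𝓗 Mi)
    case-meet-l⊆i : InUnion 𝓗 i → InUnion 𝓗 l →
      ∀ mi Mi ml Ml → IsMinCl 𝓗 i mi → IsMaxCl 𝓗 i Mi → IsMinCl 𝓗 l ml → IsMaxCl 𝓗 l Ml →
      ¬ Empty (𝓗 Mi ∩ 𝓗 Ml) → 𝓗 ml ⊆ 𝓗 mi →
      HasBar X (𝓗 ml) l × HasHat X (𝓗 Ml)
    case-meet-disj : InUnion 𝓗 i → InUnion 𝓗 l →
      ∀ mi Mi ml Ml → IsMinCl 𝓗 i mi → IsMaxCl 𝓗 i Mi → IsMinCl 𝓗 l ml → IsMaxCl 𝓗 l Ml →
      ¬ Empty (𝓗 Mi ∩ 𝓗 Ml) → Empty (𝓗 mi ∩ 𝓗 ml) →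
      HasBar X (𝓗 mi) i × HasBar X (𝓗 ml) l × HasHat X (𝓗 Mi)
    case-i-only : InUnion 𝓗 i → ¬ InUnion 𝓗 l →
      ∀ mi Mi → IsMinCl 𝓗 i mi → IsMaxCl 𝓗 i Mi →
      HasBar X (𝓗 mi) i × HasHat X (𝓗 Mi)
    case-l-only : InUnion 𝓗 l → ¬ InUnion 𝓗 i →
      ∀ ml Ml → IsMinCl 𝓗 l ml → IsMaxCl 𝓗 l Ml →
      HasBar X (𝓗 ml) l × HasHat X (𝓗 Ml)

-- The free ℤ-module ⊕_{H ∈ 𝓗} ℤH, elements = coefficient vectors on the
-- clusters (𝓗 is finite, so these are exactly the finitely supported ones).
FreeMod : ℕ → Set
FreeMod m = Fin m → ℤ

0v : ∀ {m} → FreeMod m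
0v _ = 0ℤ

_⊕_ : ∀ {m} → FreeMod m → FreeMod m → FreeMod m
(u ⊕ v) b = u b + v b

_⊖_ : ∀ {m} → FreeMod m → FreeMod m → FreeMod m
(u ⊖ v) b = u b - v b

basis : ∀ {m} → Fin m → FreeMod m
basis a b = if does (a ≟ b) then 1ℤ else 0ℤ

Σv : ∀ {m k} → (Fin m → FreeMod k) → FreeMod k
Σv {zero}  f = 0v
Σv {suc m} f = f zero ⊕ Σv (λ a → f (suc a))

sumWhere : ∀ {m} → (Fin m → Bool) → FreeMod m
sumWhere P = Σv (λ a → if P a then basis a else 0v)

selects : ∀ {n} → Subset n → Subset n → Bool
selects H S = does (nonempty? (H ∩ S)) ∧ not (does (S ⊆? H))

clusterSum : ∀ {n m} → Family n m → Fin n → Subset n → FreeMod m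
clusterSum 𝓗 t X = sumWhere (λ a → selects (𝓗 a) (⁅ t ⁆ ∪ X))

-- The two sums run over the same clusters.  Admissibility forbids a cluster
-- containing {i} ∪ X or {l} ∪ X, so H is selected by {t} ∪ X exactly when H
-- meets X or contains t.  For H disjoint from X, admissibility puts an element
-- of X into m_i ⊆ H whenever i ∈ H, unless m_l ⊆ m_i, in which case l ∈ H; by
-- symmetry H contains i iff it contains l.
module Submission where

open import Defs
open import Data.Nat using (ℕ; zero; suc; _≤_; _∸_)
open import Data.Fin using (Fin; zero; suc)
open import Data.Fin.Properties using (any?)
open import Data.Fin.Subset using (Subset; _∉_; ∣_∣; _∈_; _⊆_; _∩_; _∪_; ⁅_⁆; Nonempty; Empty; ⊥)
open import Data.Fin.Subset.Properties
  using (nonempty?; _⊆?_; _∈?_; ∩-comm; p∩q⊆p; p∩q⊆q; x∈p∩q⁺; x∈p∩q⁻; x∈p∪q⁺; x∈p∪q⁻; x∈⁅x⁆; x∈⁅y⁆⇒x≡y; ∉⊥; ⊆-trans)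
open import Data.Integer.Properties using (i≡j⇒i-j≡0)
open import Data.Bool using (Bool; true; _∧_; _∨_; not; if_then_else_)
open import Data.Bool.Properties using (∧-identityʳ)
open import Data.Product using (_×_; ∃; _,_; proj₁; proj₂; swap)
open import Data.Sum using (_⊎_; inj₁; inj₂; [_,_]) renaming (swap to ⊎-swap)
open import Data.Empty using () renaming (⊥-elim to absurd)
open import Function using (_∘_)
open import Function.Bundles using (_⇔_; mk⇔)
open import Relation.Nullary using (¬_; does; yes; no; Dec; _⊎-dec_)
open import Relation.Nullary.Decidable using (dec-false; does-⇔)
open import Relation.Unary using (Decidable)
open import Relation.Binary.PropositionalEquality
  using (_≡_; refl; sym; cong; cong₂; cong-app; subst; module ≡-Reasoning)

∃-least : ∀ {m} {P : Fin m → Set} (_≼_ : Fin m → Fin m → Set) →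
  (∀ {a} → a ≼ a) → (∀ {a b c} → a ≼ b → b ≼ c → a ≼ c) →
  (∀ {a b} → P a → P b → a ≼ b ⊎ b ≼ a) →
  Decidable P → ∃ P → ∃ λ a → P a × (∀ b → P b → a ≼ b)
∃-least {suc m} {P} _≼_ ≼-refl ≼-trans ≼-total P? ∃P with P? zero | any? (P? ∘ suc)
... | no ¬p₀ | no ¬tail = absurd ([ ¬p₀ , ¬tail ] (split ∃P))
  where
  split : ∃ P → P zero ⊎ ∃ (P ∘ suc)
  split (zero , p) = inj₁ p
  split (suc b , p) = inj₂ (b , p)
... | yes p₀ | no ¬tail = zero , p₀ , λ where
          zero _ → ≼-refl
          (suc b) p → absurd (¬tail (b , p))
... | p₀? | yes tail with ∃-least (λ a b → suc a ≼ suc b) ≼-refl ≼-trans ≼-total (P? ∘ suc) tail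
...   | a , pa , least with p₀?
...     | no ¬p₀ = suc a , pa , λ where
          zero p₀ → absurd (¬p₀ p₀)
          (suc b) p → least b p
...     | yes p₀ with ≼-total p₀ pa
...       | inj₁ 0≼a = zero , p₀ , λ where
          zero _ → ≼-refl
          (suc b) p → ≼-trans 0≼a (least b p)
...       | inj₂ a≼0 = suc a , pa , λ where
          zero _ → a≼0
          (suc b) p → least b p

module _ {n : ℕ} {p q : Subset n} where

  p∩q≡⊥⇒Empty : p ∩ q ≡ ⊥ → Empty (p ∩ q)
  p∩q≡⊥⇒Empty eq (x , x∈p∩q) = ∉⊥ (subst (x ∈_) eq x∈p∩q)

  p∩q≡p⇒p⊆q : p ∩ q ≡ p → p ⊆ q
  p∩q≡p⇒p⊆q eq {x} x∈p = p∩q⊆q p q (subst (x ∈_) (sym eq) x∈p)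

  p∩q≡q⇒q⊆p : p ∩ q ≡ q → q ⊆ p
  p∩q≡q⇒q⊆p eq {x} x∈q = p∩q⊆p p q (subst (x ∈_) (sym eq) x∈q)

  Empty-∩-comm : Empty (p ∩ q) → Empty (q ∩ p)
  Empty-∩-comm = subst Empty (∩-comm p q)

module _ {n : ℕ} {X : Subset n} where

  HasBar-mono : ∀ {S H t} → S ⊆ H → HasBar X S t → HasBar X H t
  HasBar-mono S⊆H (x , x∈X , x∈S , x≢t) = x , x∈X , S⊆H x∈S , x≢t

  HasHat-antimono : ∀ {M N} → N ⊆ M → HasHat X M → HasHat X N
  HasHat-antimono N⊆M (x , x∈X , x∉M) = x , x∈X , x∉M ∘ N⊆M

  HasHat⇒⊈ : ∀ {M} → HasHat X M → ¬ (X ⊆ M)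
  HasHat⇒⊈ (x , x∈X , x∉M) X⊆M = x∉M (X⊆M x∈X)

  selects-⁅t⁆∪X : ∀ {H t} → ¬ (t ∈ H × X ⊆ H) →
    selects H (⁅ t ⁆ ∪ X) ≡ does (nonempty? (H ∩ X)) ∨ does (t ∈? H)
  selects-⁅t⁆∪X {H} {t} ¬⊇ = begin
    does (nonempty? (H ∩ S)) ∧ not (does (S ⊆? H))
      ≡⟨ cong₂ (λ b c → b ∧ not c) (does-⇔ meets⇔ (nonempty? (H ∩ S)) (nonempty? (H ∩ X) ⊎-dec t ∈? H)) (dec-false (S ⊆? H) (¬⊇ ∘ split)) ⟩
    (does (nonempty? (H ∩ X)) ∨ does (t ∈? H)) ∧ true
      ≡⟨ ∧-identityʳ _ ⟩
    does (nonempty? (H ∩ X)) ∨ does (t ∈? H) ∎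
    where
    open ≡-Reasoning
    S = ⁅ t ⁆ ∪ X

    split : S ⊆ H → t ∈ H × X ⊆ H
    split S⊆H = S⊆H (x∈p∪q⁺ (inj₁ (x∈⁅x⁆ t))) , S⊆H ∘ x∈p∪q⁺ ∘ inj₂

    meets⇔ : Nonempty (H ∩ S) ⇔ (Nonempty (H ∩ X) ⊎ t ∈ H)
    meets⇔ = mk⇔ to from
      where
      to : Nonempty (H ∩ S) → Nonempty (H ∩ X) ⊎ t ∈ H
      to (x , x∈H∩S) with x∈p∩q⁻ H S x∈H∩S
      ... | x∈H , x∈S with x∈p∪q⁻ ⁅ t ⁆ X x∈S
      ...   | inj₁ x∈⁅t⁆ = inj₂ (subst (_∈ H) (x∈⁅y⁆⇒x≡y t x∈⁅t⁆) x∈H)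
      ...   | inj₂ x∈X = inj₁ (x , x∈p∩q⁺ (x∈H , x∈X))
      from : Nonempty (H ∩ X) ⊎ t ∈ H → Nonempty (H ∩ S)
      from (inj₁ (x , x∈H∩X)) with x∈p∩q⁻ H X x∈H∩X
      ... | x∈H , x∈X = x , x∈p∩q⁺ (x∈H , x∈p∪q⁺ (inj₂ x∈X))
      from (inj₂ t∈H) = t , x∈p∩q⁺ (t∈H , x∈p∪q⁺ (inj₁ (x∈⁅x⁆ t)))

Σv-cong : ∀ {m k} {f g : Fin m → FreeMod k} → (∀ a → f a ≡ g a) → Σv f ≡ Σv g
Σv-cong {zero} f≗g = refl
Σv-cong {suc m} f≗g = cong₂ _⊕_ (f≗g zero) (Σv-cong (f≗g ∘ suc))

sumWhere-cong : ∀ {m} {P Q : Fin m → Bool} → (∀ a → P a ≡ Q a) → sumWhere P ≡ sumWhere Q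
sumWhere-cong P≗Q = Σv-cong λ a → cong (λ β → if β then basis a else 0v) (P≗Q a)

module Hierarchy {n m : ℕ} {𝓗 : Family n m} (hier : IsHierarchy 𝓗) where
  open IsHierarchy hier using (laminar)

  nested : ∀ a b → Empty (𝓗 a ∩ 𝓗 b) ⊎ 𝓗 a ⊆ 𝓗 b ⊎ 𝓗 b ⊆ 𝓗 a
  nested a b with laminar a b
  ... | inj₁ eq = inj₁ (p∩q≡⊥⇒Empty eq)
  ... | inj₂ (inj₁ eq) = inj₂ (inj₁ (p∩q≡p⇒p⊆q eq))
  ... | inj₂ (inj₂ eq) = inj₂ (inj₂ (p∩q≡q⇒q⊆p eq))

  ⊆-total-at : ∀ {t a b} → t ∈ 𝓗 a → t ∈ 𝓗 b → 𝓗 a ⊆ 𝓗 b ⊎ 𝓗 b ⊆ 𝓗 a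
  ⊆-total-at {t} {a} {b} t∈a t∈b with nested a b
  ... | inj₁ disjoint = absurd (disjoint (t , x∈p∩q⁺ (t∈a , t∈b)))
  ... | inj₂ nest = nest

  minCl-∃ : ∀ {t} → InUnion 𝓗 t → ∃ (IsMinCl 𝓗 t)
  minCl-∃ {t} = ∃-least (λ a b → 𝓗 a ⊆ 𝓗 b) (λ x → x) (λ r s → s ∘ r) ⊆-total-at (λ a → t ∈? 𝓗 a)

  maxCl-∃ : ∀ {t} → InUnion 𝓗 t → ∃ (IsMaxCl 𝓗 t)
  maxCl-∃ {t} = ∃-least (λ a b → 𝓗 b ⊆ 𝓗 a) (λ x → x) (λ r s → r ∘ s)
    (λ t∈a t∈b → ⊎-swap (⊆-total-at t∈a t∈b)) (λ a → t ∈? 𝓗 a)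

  maxCl-meet⇒⊆ : ∀ {t u Mt Mu} → IsMaxCl 𝓗 t Mt → IsMaxCl 𝓗 u Mu →
    ¬ Empty (𝓗 Mt ∩ 𝓗 Mu) → 𝓗 Mt ⊆ 𝓗 Mu
  maxCl-meet⇒⊆ {Mt = Mt} {Mu} _ (u∈Mu , maxU) meet with nested Mt Mu
  ... | inj₁ disjoint = absurd (meet disjoint)
  ... | inj₂ (inj₁ Mt⊆Mu) = Mt⊆Mu
  ... | inj₂ (inj₂ Mu⊆Mt) = maxU Mt (Mu⊆Mt u∈Mu)

  Admissible-sym : ∀ {i l X} → Admissible 𝓗 i l X → Admissible 𝓗 l i X
  Admissible-sym adm = record
    { case-disj = λ ul ui ml Ml mi Mi minL maxL minI maxI disjoint →
        swap (case-disj ui ul mi Mi ml Ml minI maxI minL maxL (Empty-∩-comm disjoint))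
    ; case-meet-i⊆l = λ ul ui ml Ml mi Mi minL maxL minI maxI meet →
        case-meet-l⊆i ui ul mi Mi ml Ml minI maxI minL maxL (meet ∘ Empty-∩-comm)
    ; case-meet-l⊆i = λ ul ui ml Ml mi Mi minL maxL minI maxI meet →
        case-meet-i⊆l ui ul mi Mi ml Ml minI maxI minL maxL (meet ∘ Empty-∩-comm)
    ; case-meet-disj = λ ul ui ml Ml mi Mi minL maxL minI maxI meet disjoint →
        let bar-i , bar-l , hat-i = case-meet-disj ui ul mi Mi ml Ml minI maxI minL maxL
                                      (meet ∘ Empty-∩-comm) (Empty-∩-comm disjoint)
        in bar-l , bar-i , HasHat-antimono (maxCl-meet⇒⊆ maxL maxI meet) hat-i
    ; case-i-only = case-l-only
    ; case-l-only = case-i-only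
    }
    where open Admissible adm

  module _ {i l X} (adm : Admissible 𝓗 i l X) where
    open Admissible adm

    admissible-at-i : InUnion 𝓗 i → ∀ {mi Mi} → IsMinCl 𝓗 i mi → IsMaxCl 𝓗 i Mi →
      ¬ (X ⊆ 𝓗 Mi) × (HasBar X (𝓗 mi) i ⊎ l ∈ 𝓗 mi)
    admissible-at-i ui {mi} {Mi} minI maxI with any? (λ a → l ∈? 𝓗 a)
    ... | no ¬ul = let bar , hat = case-i-only ui ¬ul mi Mi minI maxI in HasHat⇒⊈ hat , inj₁ bar
    ... | yes ul with minCl-∃ ul | maxCl-∃ ul
    ...   | ml , minL | Ml , maxL with nonempty? (𝓗 Mi ∩ 𝓗 Ml)
    ...     | no disjoint =
      let bar-i , x , x∈X , x∈ml , _ = case-disj ui ul mi Mi ml Ml minI maxI minL maxL disjoint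
      in (λ X⊆Mi → disjoint (x , x∈p∩q⁺ (X⊆Mi x∈X , proj₂ maxL ml (proj₁ minL) x∈ml))) , inj₁ bar-i
    ...     | yes meet with nested mi ml
    ...       | inj₁ mi∩ml=∅ =
      let bar-i , _ , hat = case-meet-disj ui ul mi Mi ml Ml minI maxI minL maxL (λ e → e meet) mi∩ml=∅
      in HasHat⇒⊈ hat , inj₁ bar-i
    ...       | inj₂ (inj₁ mi⊆ml) =
      let bar-i , hat = case-meet-i⊆l ui ul mi Mi ml Ml minI maxI minL maxL (λ e → e meet) mi⊆ml
      in HasHat⇒⊈ hat , inj₁ bar-i
    ...       | inj₂ (inj₂ ml⊆mi) =
      let _ , hat = case-meet-l⊆i ui ul mi Mi ml Ml minI maxI minL maxL (λ e → e meet) ml⊆mi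
      in HasHat⇒⊈ (HasHat-antimono (maxCl-meet⇒⊆ maxI maxL (λ e → e meet)) hat) , inj₂ (ml⊆mi (proj₁ minL))

    -- m_i ⊆ H ⊆ M_i transfers the constraints from m_i and M_i to any H ∋ i.
    admissible-at-cluster∋i : ∀ a → i ∈ 𝓗 a → ¬ (X ⊆ 𝓗 a) × (HasBar X (𝓗 a) i ⊎ l ∈ 𝓗 a)
    admissible-at-cluster∋i a i∈a with minCl-∃ (a , i∈a) | maxCl-∃ (a , i∈a)
    ... | mi , minI | Mi , maxI with admissible-at-i (a , i∈a) minI maxI
    ...   | X⊈Mi , bar-or-l =
      (λ X⊆a → X⊈Mi (⊆-trans X⊆a (proj₂ maxI a i∈a))) ,
      [ inj₁ ∘ HasBar-mono (proj₂ minI a i∈a) , inj₂ ∘ proj₂ minI a i∈a ] bar-or-l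

    cluster∋i⇒⊉X : ∀ a → ¬ (i ∈ 𝓗 a × X ⊆ 𝓗 a)
    cluster∋i⇒⊉X a (i∈a , X⊆a) = proj₁ (admissible-at-cluster∋i a i∈a) X⊆a

    cluster∌X∋i⇒∋l : ∀ a → Empty (𝓗 a ∩ X) → i ∈ 𝓗 a → l ∈ 𝓗 a
    cluster∌X∋i⇒∋l a disjoint i∈a with proj₂ (admissible-at-cluster∋i a i∈a)
    ... | inj₁ (x , x∈X , x∈a , _) = absurd (disjoint (x , x∈p∩q⁺ (x∈a , x∈X)))
    ... | inj₂ l∈a = l∈a

  selects-i≡selects-l : ∀ {i l X} → Admissible 𝓗 i l X →
    ∀ a → selects (𝓗 a) (⁅ i ⁆ ∪ X) ≡ selects (𝓗 a) (⁅ l ⁆ ∪ X)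
  selects-i≡selects-l {i} {l} {X} adm a = begin
    selects H (⁅ i ⁆ ∪ X)                     ≡⟨ selects-⁅t⁆∪X (cluster∋i⇒⊉X adm a) ⟩
    does (nonempty? (H ∩ X)) ∨ does (i ∈? H)  ≡⟨ same-if-disjoint (nonempty? (H ∩ X)) ⟩
    does (nonempty? (H ∩ X)) ∨ does (l ∈? H)  ≡⟨ sym (selects-⁅t⁆∪X (cluster∋i⇒⊉X (Admissible-sym adm) a)) ⟩
    selects H (⁅ l ⁆ ∪ X)                     ∎
    where
    open ≡-Reasoning
    H = 𝓗 a

    same-if-disjoint : (meets? : Dec (Nonempty (H ∩ X))) →
      does meets? ∨ does (i ∈? H) ≡ does meets? ∨ does (l ∈? H)
    same-if-disjoint (yes _) = refl
    same-if-disjoint (no disjoint) = does-⇔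
      (mk⇔ (cluster∌X∋i⇒∋l adm a disjoint) (cluster∌X∋i⇒∋l (Admissible-sym adm) a disjoint))
      (i ∈? H) (l ∈? H)

lemma4p1 : (k n : ℕ) → 4 ≤ k → k ≤ n ∸ 2 →
    {m : ℕ} (𝓗 : Family n m) → IsHierarchy 𝓗 →
    (∀ a → 2 ≤ ∣ 𝓗 a ∣) → (∀ a → ∣ 𝓗 a ∣ ≤ n ∸ k) →
    (i l : Fin n) (X : Subset n) → i ∉ X → l ∉ X → ∣ X ∣ ≡ k ∸ 1 →
    Admissible 𝓗 i l X →
    ∀ b → (clusterSum 𝓗 i X ⊖ clusterSum 𝓗 l X) b ≡ 0v b
lemma4p1 _ _ _ _ 𝓗 hier _ _ i l X _ _ _ adm b =
  i≡j⇒i-j≡0 (cong-app (sumWhere-cong (Hierarchy.selects-i≡selects-l hier adm)) b)
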